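{- Let $\mathbb{K}$ be a field, $X$ a countable alphabet and $\Box_E$ an end weak shuffle product on $\mathbb{K}\langle X\rangle$ with associated maps $f_{1,E},f_{2,E}$, such that $f_{1,E}(a\otimes a)\in\{0,1\}$ for every letter $a\in X$. Define products $\wedge$ and $\vee$ on the span of non-empty words by $$ua\wedge vb=f_{1,E}(a\otimes b)\,(u\Box_E vb)a,\qquad ua\vee vb=f_{2,E}(a\otimes b)\,(ua\Box_E v)b$$ for all letters $a,b$ and words $u,v$, extended bilinearly. Then this space with $\wedge,\vee$ is a dendriform algebra, i.e. for all $x,y,z$: $(x\wedge y)\wedge z=x\wedge(y\wedge z)+x\wedge(y\vee z)$, $(x\vee y)\wedge z=x\vee(y\wedge z)$, and $(x\wedge y)\vee z+(x\vee y)\vee z=x\vee(y\vee z)$.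
   Context: An alphabet is a non-empty finite or countable set $X$; $X^*$ is the set of words (empty word $1$), $\mathbb{K}\langle X\rangle$ the vector space with basis $X^*$, juxtaposition is concatenation. An end weak shuffle product on $\mathbb{K}\langle X\rangle$ is an associative and commutative bilinear product $\Box_E$ with $u\Box_E 1=1\Box_E u=u$, $u\Box_E 0=0\Box_E u=0$, and $ua\Box_E vb=f_{1,E}(a\otimes b)(u\Box_E vb)a+f_{2,E}(a\otimes b)(ua\Box_E v)b$ for all letters $a,b$ and words $u,v$, where $f_{1,E},f_{2,E}:\mathbb{K}.X\otimes\mathbb{K}.X\to\mathbb{K}$ are linear. -}

module Defs where

open import Level using (Level; _⊔_; suc)
open import Data.Nat using (ℕ) renaming (_≟_ to _≟ℕ_)
open import Data.List using (List; []; _∷_; _∷ʳ_; _++_; map; concatMap)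
open import Data.List.Properties using (≡-dec)
open import Data.Product using (_×_; _,_; Σ; ∃)
open import Data.Sum using (_⊎_)
open import Relation.Binary.PropositionalEquality using (_≡_; cong)
open import Relation.Nullary using (¬_; Dec; yes; no)
open import Relation.Nullary.Decidable using (map′)
open import Relation.Binary using (DecidableEquality)
open import Function.Definitions using (Injective)
open import Algebra.Bundles using (CommutativeRing)

record Field (c ℓ : Level) : Set (Level.suc (c ⊔ ℓ)) where
  field
    commutativeRing : CommutativeRing c ℓ
  open CommutativeRing commutativeRing public
  field
    1≉0     : ¬ (1# ≈ 0#)
    inverse : ∀ x → ¬ (x ≈ 0#) → ∃ λ y → (x * y) ≈ 1#

-- An alphabet: a non-empty type X that is finite or countable, i.e. admits an
-- injection enc : X → ℕ.
record Alphabet : Set₁ where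
  field
    Letter : Set
    enc    : Letter → ℕ
    enc-injective : Injective _≡_ _≡_ enc
    someLetter : Letter

  _≟X_ : DecidableEquality Letter
  x ≟X y = map′ enc-injective (cong enc) (enc x ≟ℕ enc y)

module KX {c ℓ : Level} (K : Field c ℓ) (A : Alphabet) where
  open Field K
  open Alphabet A

  -- words X*, empty word = []; the word "u a" (u followed by letter a) is u ∷ʳ a
  Word : Set
  Word = List Letter

  _≟W_ : DecidableEquality Word
  _≟W_ = ≡-dec _≟X_

  -- an element of K⟨X⟩ represented as a finite formal linear combination of words
  Poly : Set c
  Poly = List (Carrier × Word)

  coeff : Poly → Word → Carrier
  coeff [] w = 0#
  coeff ((k , u) ∷ p) w with u ≟W w
  ... | yes _ = k + coeff p w
  ... | no  _ = coeff p w

  _≈P_ : Poly → Poly → Set ℓ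
  p ≈P q = ∀ w → coeff p w ≈ coeff q w

  infix 4 _≈P_

  ⟦_⟧ : Word → Poly
  ⟦ u ⟧ = (1# , u) ∷ []

  scale : Carrier → Poly → Poly
  scale k = map (λ { (d , w) → (k * d , w) })

  _·ʳ_ : Poly → Letter → Poly
  p ·ʳ a = map (λ { (d , w) → (d , w ∷ʳ a) }) p

  bilin : (Word → Word → Poly) → Poly → Poly → Poly
  bilin m p q = concatMap (λ { (k , u) → concatMap (λ { (l , v) → scale (k * l) (m u v) }) q }) p

  -- End weak shuffle product: a bilinear product, given by its values m u v = u □_E v
  -- on basis words, together with the linear maps f₁, f₂ : K.X ⊗ K.X → K, given by
  -- their values f₁ a b = f_{1,E}(a ⊗ b) on basis tensors.
  record IsEndWeakShuffle (m : Word → Word → Poly) (f₁ f₂ : Letter → Letter → Carrier) : Set (c ⊔ ℓ) where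
    field
      assoc : ∀ p q r → bilin m (bilin m p q) r ≈P bilin m p (bilin m q r)
      comm  : ∀ p q → bilin m p q ≈P bilin m q p
      unitʳ : ∀ u → m u [] ≈P ⟦ u ⟧
      unitˡ : ∀ u → m [] u ≈P ⟦ u ⟧
      rec   : ∀ u v a b →
              m (u ∷ʳ a) (v ∷ʳ b)
                ≈P scale (f₁ a b) (m u (v ∷ʳ b) ·ʳ a) ++ scale (f₂ a b) (m (u ∷ʳ a) v ·ʳ b)

  -- The span of non-empty words.  A non-empty word u a is represented as the pair (u , a).
  NEWord : Set
  NEWord = Word × Letter

  Poly⁺ : Set c
  Poly⁺ = List (Carrier × NEWord)

  incl : Poly⁺ → Poly
  incl = map (λ { (k , (u , a)) → (k , u ∷ʳ a) })

  _≈⁺_ : Poly⁺ → Poly⁺ → Set ℓ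
  p ≈⁺ q = incl p ≈P incl q

  infix 4 _≈⁺_

  endWith : Poly → Letter → Poly⁺
  endWith p a = map (λ { (d , w) → (d , (w , a)) }) p

  bilin⁺ : (NEWord → NEWord → Poly⁺) → Poly⁺ → Poly⁺ → Poly⁺
  bilin⁺ m p q = concatMap (λ { (k , u) → concatMap (λ { (l , v) → map (λ { (d , w) → (k * l * d , w) }) (m u v) }) q }) p

  module Dendriform (m : Word → Word → Poly) (f₁ f₂ : Letter → Letter → Carrier) where
    wedgeW : NEWord → NEWord → Poly⁺
    wedgeW (u , a) (v , b) = endWith (scale (f₁ a b) (m u (v ∷ʳ b))) a

    veeW : NEWord → NEWord → Poly⁺
    veeW (u , a) (v , b) = endWith (scale (f₂ a b) (m (u ∷ʳ a) v)) b

    _∧_ : Poly⁺ → Poly⁺ → Poly⁺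
    _∧_ = bilin⁺ wedgeW

    _∨_ : Poly⁺ → Poly⁺ → Poly⁺
    _∨_ = bilin⁺ veeW

    _⊕_ : Poly⁺ → Poly⁺ → Poly⁺
    _⊕_ = _++_

    infixl 7 _∧_ _∨_
    infixl 6 _⊕_

    record IsDendriform : Set (c ⊔ ℓ) where
      field
        dend₁ : ∀ x y z → (x ∧ y) ∧ z ≈⁺ (x ∧ (y ∧ z)) ⊕ (x ∧ (y ∨ z))
        dend₂ : ∀ x y z → (x ∨ y) ∧ z ≈⁺ x ∨ (y ∧ z)
        dend₃ : ∀ x y z → ((x ∧ y) ∨ z) ⊕ ((x ∨ y) ∨ z) ≈⁺ x ∨ (y ∨ z)

-- Equalities in K⟨X⟩ are handled through the pairing ⟪ p ∣ F ⟫ = Σ kᵢ F(wᵢ) of a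
-- formal sum p = Σ kᵢ wᵢ with an arbitrary test function F: two formal sums are
-- equal iff all their pairings agree (≈⁺-from-pairing, pair-resp).  In this
-- language the axioms of □ become identities between pairings (rec-pair,
-- comm-pair, assoc-pair).
--
-- On basis words u a, v b, w c the dendriform axioms reduce, via associativity and
-- the recursion of □, to four polynomial identities between the structure
-- constants of the letters a, b, c (record Coherent).  These are proved by cases
-- on which of a, b, c coincide.  In each case the letters are indexed by Fin d
-- (d = 1, 2, 3) and products of short words are expanded formally, with
-- polynomial coefficients in the structure constants (Labelled.expand).  Comparing
-- coefficients in commutativity and associativity gives polynomial relations, and
-- each coherence identity is an explicit linear combination of these relations
-- and of f₁(a,a)² = f₁(a,a), verified by ring normalisation (Certificates).

module Submission where

open import Defs
open import Level using (Level)
open import Function using (_∘_)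
open import Data.Empty using (⊥-elim)
open import Data.Sum using (_⊎_; inj₁; inj₂)
open import Data.Product using (_×_; _,_; proj₁; proj₂; map₁; map₂)
open import Data.Nat using (ℕ) renaming (_*_ to _*ℕ_)
open import Data.Fin as Fin using (Fin; combine; remQuot)
open import Data.Fin.Properties using (remQuot-combine) renaming (_≟_ to _≟Fin_)
open import Data.Vec using (Vec; tabulate)
open import Data.Vec.Properties using (lookup∘tabulate)
open import Data.List using (List; []; _∷_; [_]; _∷ʳ_; _++_; map; concatMap; reverse; deduplicate)
open import Data.List.Properties using (≡-dec; map-++; unfold-reverse; reverse-involutive; map-injective)
open import Data.List.Membership.Propositional using (_∈_)
open import Data.List.Membership.Propositional.Properties using (∈-++⁺ˡ; ∈-++⁺ʳ; ∈-deduplicate⁺)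
open import Data.List.Relation.Unary.Any using (here; there)
open import Data.List.Relation.Unary.All as All using ()
open import Data.List.Relation.Unary.AllPairs using (_∷_)
open import Data.List.Relation.Unary.Unique.Propositional using (Unique)
import Data.List.Relation.Unary.Unique.DecPropositional.Properties as UniqueProperties
open import Relation.Binary.PropositionalEquality as ≡ using (_≡_; _≢_)
open import Relation.Nullary using (yes; no)
open import Function.Definitions using (Injective)
import Algebra.Properties.Ring as RingProperties
import Algebra.Properties.CommutativeSemigroup as CommutativeSemigroupProperties
import Relation.Binary.Reasoning.Setoid as SetoidReasoning
import Algebra.Solver.Ring.NaturalCoefficients.Default as NaturalSolver

module Proof {c ℓ : Level} (K : Field c ℓ) (Alph : Alphabet) where
  open Field K hiding (zero)
  open Alphabet Alph
  open KX K Alph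
  open SetoidReasoning setoid
  open RingProperties ring using (+-cancelʳ)
  open CommutativeSemigroupProperties *-commutativeSemigroup using () renaming (x∙yz≈y∙xz to x*[y*z]≈y*[x*z])
  open CommutativeSemigroupProperties +-commutativeSemigroup using () renaming (interchange to +-interchange)
  open NaturalSolver commutativeSemiring
    using (Polynomial; var; con; _:+_; _:*_; ⟦_⟧↓; prove; solve; _:=_)
    renaming (⟦_⟧ to ⟦_⟧ᶜ)

  ⟪_∣_⟫ : {A : Set} → List (Carrier × A) → (A → Carrier) → Carrier
  ⟪ [] ∣ F ⟫ = 0#
  ⟪ (k , x) ∷ p ∣ F ⟫ = k * F x + ⟪ p ∣ F ⟫

  module _ {A : Set} where
    pair-cong : ∀ (p : List (Carrier × A)) {F G} → (∀ x → F x ≈ G x) → ⟪ p ∣ F ⟫ ≈ ⟪ p ∣ G ⟫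
    pair-cong [] e = refl
    pair-cong ((k , x) ∷ p) e = +-cong (*-congˡ (e x)) (pair-cong p e)

    pair-++ : ∀ (p q : List (Carrier × A)) F → ⟪ p ++ q ∣ F ⟫ ≈ ⟪ p ∣ F ⟫ + ⟪ q ∣ F ⟫
    pair-++ [] q F = sym (+-identityˡ _)
    pair-++ ((k , x) ∷ p) q F = trans (+-congˡ (pair-++ p q F)) (sym (+-assoc _ _ _))

    pair-*ˡ : ∀ (p : List (Carrier × A)) k F → ⟪ p ∣ (λ x → k * F x) ⟫ ≈ k * ⟪ p ∣ F ⟫
    pair-*ˡ [] k F = sym (zeroʳ k)
    pair-*ˡ ((d , x) ∷ p) k F = begin
      d * (k * F x) + ⟪ p ∣ (λ x → k * F x) ⟫ ≈⟨ +-cong (x*[y*z]≈y*[x*z] d k (F x)) (pair-*ˡ p k F) ⟩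
      k * (d * F x) + k * ⟪ p ∣ F ⟫         ≈⟨ sym (distribˡ k _ _) ⟩
      k * (d * F x + ⟪ p ∣ F ⟫)             ∎

    pair-pull : ∀ (p : List (Carrier × A)) k {F Φ} → (∀ x → F x ≈ k * Φ x) → ⟪ p ∣ F ⟫ ≈ k * ⟪ p ∣ Φ ⟫
    pair-pull p k e = trans (pair-cong p e) (pair-*ˡ p k _)

    pair-+ : ∀ (p : List (Carrier × A)) F G → ⟪ p ∣ (λ x → F x + G x) ⟫ ≈ ⟪ p ∣ F ⟫ + ⟪ p ∣ G ⟫
    pair-+ [] F G = sym (+-identityˡ 0#)
    pair-+ ((d , x) ∷ p) F G = trans (+-cong (distribˡ d _ _) (pair-+ p F G)) (+-interchange _ _ _ _)

    pair-zero : ∀ (p : List (Carrier × A)) {F} → (∀ x → F x ≈ 0#) → ⟪ p ∣ F ⟫ ≈ 0#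
    pair-zero [] e = refl
    pair-zero ((d , x) ∷ p) e = trans (+-cong (trans (*-congˡ (e x)) (zeroʳ d)) (pair-zero p e)) (+-identityˡ 0#)

    pair-scale : ∀ k (p : List (Carrier × A)) F → ⟪ map (λ { (d , x) → (k * d , x) }) p ∣ F ⟫ ≈ k * ⟪ p ∣ F ⟫
    pair-scale k [] F = sym (zeroʳ k)
    pair-scale k ((d , x) ∷ p) F = trans (+-cong (*-assoc k d (F x)) (pair-scale k p F)) (sym (distribˡ k _ _))

    pair-relabel : ∀ {B : Set} (f : A → B) (p : List (Carrier × A)) F →
                   ⟪ map (λ { (d , x) → (d , f x) }) p ∣ F ⟫ ≈ ⟪ p ∣ F ∘ f ⟫
    pair-relabel f [] F = refl
    pair-relabel f ((d , x) ∷ p) F = +-congˡ (pair-relabel f p F)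


  pair-concatMap : ∀ {A B : Set} (p : List (Carrier × A)) (g : Carrier × A → List (Carrier × B)) F H →
                   (∀ k x → ⟪ g (k , x) ∣ F ⟫ ≈ k * H x) → ⟪ concatMap g p ∣ F ⟫ ≈ ⟪ p ∣ H ⟫
  pair-concatMap [] g F H e = refl
  pair-concatMap ((k , x) ∷ p) g F H e =
    trans (pair-++ (g (k , x)) (concatMap g p) F) (+-cong (e k x) (pair-concatMap p g F H e))

  pair-swap : ∀ {A B : Set} (p : List (Carrier × A)) (q : List (Carrier × B)) (H : A → B → Carrier) →
              ⟪ p ∣ (λ x → ⟪ q ∣ H x ⟫) ⟫ ≈ ⟪ q ∣ (λ y → ⟪ p ∣ (λ x → H x y) ⟫) ⟫
  pair-swap [] q H = sym (pair-zero q (λ _ → refl))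
  pair-swap ((k , x) ∷ p) q H = begin
    k * ⟪ q ∣ H x ⟫ + ⟪ p ∣ (λ x → ⟪ q ∣ H x ⟫) ⟫
      ≈⟨ +-cong (sym (pair-*ˡ q k (H x))) (pair-swap p q H) ⟩
    ⟪ q ∣ (λ y → k * H x y) ⟫ + ⟪ q ∣ (λ y → ⟪ p ∣ (λ x → H x y) ⟫) ⟫
      ≈⟨ pair-+ q _ _ ⟨
    ⟪ q ∣ (λ y → k * H x y + ⟪ p ∣ (λ x → H x y) ⟫) ⟫ ∎

  pair-⟦⟧ : ∀ u (F : Word → Carrier) → ⟪ ⟦ u ⟧ ∣ F ⟫ ≈ F u
  pair-⟦⟧ u F = trans (+-identityʳ _) (*-identityˡ _)

  pair-bilinear : ∀ {A B C : Set} (M : A → B → List (Carrier × C)) p q F →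
    ⟪ concatMap (λ { (k , x) → concatMap (λ { (l , y) → map (λ { (d , z) → (k * l * d , z) }) (M x y) }) q })
                p ∣ F ⟫
      ≈ ⟪ p ∣ (λ x → ⟪ q ∣ (λ y → ⟪ M x y ∣ F ⟫) ⟫) ⟫
  pair-bilinear M p q F = pair-concatMap p _ F _ λ k x →
    trans (pair-concatMap q _ F (λ y → k * ⟪ M x y ∣ F ⟫) λ l y →
             trans (pair-scale (k * l) (M x y) F) (trans (*-congʳ (*-comm k l)) (*-assoc l k _)))
          (pair-*ˡ q k _)

  δ : Word → Word → Carrier
  δ w u with u ≟W w
  ... | yes _ = 1#
  ... | no _ = 0#

  δ-same : ∀ w → δ w w ≈ 1#
  δ-same w with w ≟W w
  ... | yes _ = refl
  ... | no w≢w = ⊥-elim (w≢w ≡.refl)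

  δ-other : ∀ {w u} → u ≢ w → δ w u ≈ 0#
  δ-other {w} {u} u≢w with u ≟W w
  ... | yes u≡w = ⊥-elim (u≢w u≡w)
  ... | no _ = refl

  coeff≈pair : ∀ p w → coeff p w ≈ ⟪ p ∣ δ w ⟫
  coeff≈pair [] w = refl
  coeff≈pair ((k , u) ∷ p) w with u ≟W w
  ... | yes _ = +-cong (sym (*-identityʳ k)) (coeff≈pair p w)
  ... | no _ = trans (coeff≈pair p w) (sym (trans (+-congʳ (zeroʳ k)) (+-identityˡ _)))

  ≈⁺-from-pairing : ∀ (P Q : Poly⁺) → (∀ G → ⟪ P ∣ G ⟫ ≈ ⟪ Q ∣ G ⟫) → P ≈⁺ Q
  ≈⁺-from-pairing P Q e w = begin
    coeff (incl P) w    ≈⟨ coeff≈pair (incl P) w ⟩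
    ⟪ incl P ∣ δ w ⟫     ≈⟨ pair-relabel spell P (δ w) ⟩
    ⟪ P ∣ δ w ∘ spell ⟫  ≈⟨ e _ ⟩
    ⟪ Q ∣ δ w ∘ spell ⟫  ≈⟨ sym (pair-relabel spell Q (δ w)) ⟩
    ⟪ incl Q ∣ δ w ⟫     ≈⟨ sym (coeff≈pair (incl Q) w) ⟩
    coeff (incl Q) w    ∎
    where
    spell : NEWord → Word
    spell (u , a) = u ∷ʳ a

  -- Conversely, equal elements of K⟨X⟩ have the same pairings.  To see this, expand
  -- the pairing over a duplicate-free list D of words containing the support.
  private
    ones : List Word → Poly
    ones = map (1# ,_)

    support : Poly → List Word
    support = map proj₂

    ones-vanish : ∀ D {H : Word → Carrier} → (∀ {s} → s ∈ D → H s ≈ 0#) → ⟪ ones D ∣ H ⟫ ≈ 0#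
    ones-vanish [] e = refl
    ones-vanish (s ∷ D) e =
      trans (+-cong (trans (*-congˡ (e (here ≡.refl))) (zeroʳ 1#)) (ones-vanish D (e ∘ there))) (+-identityˡ 0#)

    ones-pick : ∀ D → Unique D → ∀ {u} → u ∈ D → ∀ (G : Word → Carrier) →
                ⟪ ones D ∣ (λ s → δ s u * G s) ⟫ ≈ G u
    ones-pick (s ∷ D) (s∉D ∷ _) (here ≡.refl) G =
      trans (+-cong (trans (*-identityˡ _) (trans (*-congʳ (δ-same s)) (*-identityˡ _)))
                    (ones-vanish D (λ s'∈D → trans (*-congʳ (δ-other (All.lookup s∉D s'∈D))) (zeroˡ _))))
            (+-identityʳ _)
    ones-pick (s ∷ D) (s∉D ∷ uD) (there u∈D) G =
      trans (+-cong (trans (*-identityˡ _)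
                           (trans (*-congʳ (δ-other (λ e → All.lookup s∉D u∈D (≡.sym e)))) (zeroˡ _)))
                    (ones-pick D uD u∈D G))
            (+-identityˡ _)

    pair-cong-∈ : ∀ (p : Poly) {F G : Word → Carrier} → (∀ {u} → u ∈ support p → F u ≈ G u) →
                  ⟪ p ∣ F ⟫ ≈ ⟪ p ∣ G ⟫
    pair-cong-∈ [] e = refl
    pair-cong-∈ ((k , x) ∷ p) e = +-cong (*-congˡ (e (here ≡.refl))) (pair-cong-∈ p (e ∘ there))

    pair-over : ∀ p D → Unique D → (∀ {u} → u ∈ support p → u ∈ D) → ∀ (G : Word → Carrier) →
                ⟪ p ∣ G ⟫ ≈ ⟪ ones D ∣ (λ s → coeff p s * G s) ⟫
    pair-over p D uD sub G = begin
      ⟪ p ∣ G ⟫                                     ≈⟨ pair-cong-∈ p (λ u∈p → sym (ones-pick D uD (sub u∈p) G)) ⟩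
      ⟪ p ∣ (λ u → ⟪ ones D ∣ (λ s → δ s u * G s) ⟫) ⟫ ≈⟨ pair-swap p (ones D) _ ⟩
      ⟪ ones D ∣ (λ s → ⟪ p ∣ (λ u → δ s u * G s) ⟫) ⟫ ≈⟨ pair-cong (ones D) coefficient ⟩
      ⟪ ones D ∣ (λ s → coeff p s * G s) ⟫          ∎
      where
      coefficient : ∀ s → ⟪ p ∣ (λ u → δ s u * G s) ⟫ ≈ coeff p s * G s
      coefficient s = trans (pair-cong p (λ u → *-comm (δ s u) (G s)))
                     (trans (pair-*ˡ p (G s) (δ s)) (trans (*-comm _ _) (*-congʳ (sym (coeff≈pair p s)))))

  pair-resp : ∀ p q → p ≈P q → ∀ (G : Word → Carrier) → ⟪ p ∣ G ⟫ ≈ ⟪ q ∣ G ⟫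
  pair-resp p q p≈q G = begin
    ⟪ p ∣ G ⟫                             ≈⟨ pair-over p D unique (∈-deduplicate⁺ _≟W_ ∘ ∈-++⁺ˡ) G ⟩
    ⟪ ones D ∣ (λ s → coeff p s * G s) ⟫  ≈⟨ pair-cong (ones D) (λ s → *-congʳ (p≈q s)) ⟩
    ⟪ ones D ∣ (λ s → coeff q s * G s) ⟫  ≈⟨ pair-over q D unique (∈-deduplicate⁺ _≟W_ ∘ ∈-++⁺ʳ (support p)) G ⟨
    ⟪ q ∣ G ⟫                             ∎
    where
    D = deduplicate _≟W_ (support p ++ support q)
    unique : Unique D
    unique = UniqueProperties.deduplicate-! _≟W_ (support p ++ support q)

  -- A goal P = Q follows
  -- from known relations lhsᵢ = rhsᵢ when P - Q = Σ λᵢ (lhsᵢ - rhsᵢ) as polynomials;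
  -- the latter is checked by comparing normal forms.
  module Certificates {n : ℕ} (ρ : Vec Carrier n) where
    Coef : Set
    Coef = Polynomial n

    record Relation : Set ℓ where
      constructor _≐_by_
      field
        lhs rhs : Coef
        holds : ⟦ lhs ⟧ᶜ ρ ≈ ⟦ rhs ⟧ᶜ ρ
    open Relation public
    infix 1 _≐_by_

    reversed : Relation → Relation
    reversed (l ≐ r by e) = r ≐ l by sym e

    Certificate : Set ℓ
    Certificate = List (Coef × Relation)

    only : Relation → Certificate
    only r = [ con 1 , r ]

    combination : (Relation → Coef) → Certificate → Coef
    combination side [] = con 0
    combination side ((k , r) ∷ cs) = k :* side r :+ combination side cs

    combination-holds : ∀ cs → ⟦ combination lhs cs ⟧ᶜ ρ ≈ ⟦ combination rhs cs ⟧ᶜ ρ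
    combination-holds [] = refl
    combination-holds ((k , r) ∷ cs) = +-cong (*-congˡ (holds r)) (combination-holds cs)

    Certifies : Certificate → Coef × Coef → Set ℓ
    Certifies cs (P , Q) = ⟦ P :+ combination rhs cs ⟧↓ ρ ≈ ⟦ Q :+ combination lhs cs ⟧↓ ρ

    follows : ∀ PQ cs → Certifies cs PQ → ⟦ proj₁ PQ ⟧ᶜ ρ ≈ ⟦ proj₂ PQ ⟧ᶜ ρ
    follows (P , Q) cs normal = +-cancelʳ _ _ _ (begin
      ⟦ P ⟧ᶜ ρ + ⟦ combination rhs cs ⟧ᶜ ρ ≈⟨ prove ρ (P :+ combination rhs cs) (Q :+ combination lhs cs) normal ⟩
      ⟦ Q ⟧ᶜ ρ + ⟦ combination lhs cs ⟧ᶜ ρ ≈⟨ +-congˡ (combination-holds cs) ⟩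
      ⟦ Q ⟧ᶜ ρ + ⟦ combination rhs cs ⟧ᶜ ρ ∎)

    derive : ∀ PQ cs → Certifies cs PQ → Relation
    derive PQ cs normal = proj₁ PQ ≐ proj₂ PQ by follows PQ cs normal

  module Shuffle (m : Word → Word → Poly) (f₁ f₂ : Letter → Letter → Carrier)
                 (ews : IsEndWeakShuffle m f₁ f₂) where
    private module E = IsEndWeakShuffle ews
    open Dendriform m f₁ f₂

    rec-pair : ∀ u v a b F → ⟪ m (u ∷ʳ a) (v ∷ʳ b) ∣ F ⟫
             ≈ f₁ a b * ⟪ m u (v ∷ʳ b) ∣ F ∘ (_∷ʳ a) ⟫ + f₂ a b * ⟪ m (u ∷ʳ a) v ∣ F ∘ (_∷ʳ b) ⟫
    rec-pair u v a b F =
      trans (pair-resp (m (u ∷ʳ a) (v ∷ʳ b)) (left ++ right) (E.rec u v a b) F)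
            (trans (pair-++ left right F) (+-cong (branch (f₁ a b) (m u (v ∷ʳ b)) a) (branch (f₂ a b) (m (u ∷ʳ a) v) b)))
      where
      left right : Poly
      left = scale (f₁ a b) (m u (v ∷ʳ b) ·ʳ a)
      right = scale (f₂ a b) (m (u ∷ʳ a) v ·ʳ b)
      branch : ∀ k p e → ⟪ scale k (p ·ʳ e) ∣ F ⟫ ≈ k * ⟪ p ∣ F ∘ (_∷ʳ e) ⟫
      branch k p e = trans (pair-scale k (p ·ʳ e) F) (*-congˡ (pair-relabel (_∷ʳ e) p F))

    unitˡ-pair : ∀ u (F : Word → Carrier) → ⟪ m [] u ∣ F ⟫ ≈ F u
    unitˡ-pair u F = trans (pair-resp (m [] u) ⟦ u ⟧ (E.unitˡ u) F) (pair-⟦⟧ u F)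

    unitʳ-pair : ∀ u (F : Word → Carrier) → ⟪ m u [] ∣ F ⟫ ≈ F u
    unitʳ-pair u F = trans (pair-resp (m u []) ⟦ u ⟧ (E.unitʳ u) F) (pair-⟦⟧ u F)

    pair-single : ∀ u v (F : Word → Carrier) → ⟪ bilin m ⟦ u ⟧ ⟦ v ⟧ ∣ F ⟫ ≈ ⟪ m u v ∣ F ⟫
    pair-single u v F = trans (pair-bilinear m ⟦ u ⟧ ⟦ v ⟧ F)
      (trans (pair-⟦⟧ u (λ u′ → ⟪ ⟦ v ⟧ ∣ (λ v′ → ⟪ m u′ v′ ∣ F ⟫) ⟫)) (pair-⟦⟧ v (λ v′ → ⟪ m u v′ ∣ F ⟫)))

    comm-pair : ∀ u v (F : Word → Carrier) → ⟪ m u v ∣ F ⟫ ≈ ⟪ m v u ∣ F ⟫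
    comm-pair u v F = begin
      ⟪ m u v ∣ F ⟫                ≈⟨ pair-single u v F ⟨
      ⟪ bilin m ⟦ u ⟧ ⟦ v ⟧ ∣ F ⟫  ≈⟨ pair-resp (bilin m ⟦ u ⟧ ⟦ v ⟧) (bilin m ⟦ v ⟧ ⟦ u ⟧) (E.comm ⟦ u ⟧ ⟦ v ⟧) F ⟩
      ⟪ bilin m ⟦ v ⟧ ⟦ u ⟧ ∣ F ⟫  ≈⟨ pair-single v u F ⟩
      ⟪ m v u ∣ F ⟫                ∎

    assoc-pair : ∀ u v w (F : Word → Carrier) →
                 ⟪ m u v ∣ (λ p → ⟪ m p w ∣ F ⟫) ⟫ ≈ ⟪ m v w ∣ (λ p → ⟪ m u p ∣ F ⟫) ⟫
    assoc-pair u v w F = begin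
      ⟪ m u v ∣ (λ p → ⟪ m p w ∣ F ⟫) ⟫
        ≈⟨ pair-single u v _ ⟨
      ⟪ bilin m ⟦ u ⟧ ⟦ v ⟧ ∣ (λ p → ⟪ m p w ∣ F ⟫) ⟫
        ≈⟨ pair-cong (bilin m ⟦ u ⟧ ⟦ v ⟧) (λ p → pair-⟦⟧ w (λ w′ → ⟪ m p w′ ∣ F ⟫)) ⟨
      ⟪ bilin m ⟦ u ⟧ ⟦ v ⟧ ∣ (λ p → ⟪ ⟦ w ⟧ ∣ (λ w′ → ⟪ m p w′ ∣ F ⟫) ⟫) ⟫
        ≈⟨ pair-bilinear m (bilin m ⟦ u ⟧ ⟦ v ⟧) ⟦ w ⟧ F ⟨
      ⟪ bilin m (bilin m ⟦ u ⟧ ⟦ v ⟧) ⟦ w ⟧ ∣ F ⟫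
        ≈⟨ pair-resp (bilin m (bilin m ⟦ u ⟧ ⟦ v ⟧) ⟦ w ⟧) (bilin m ⟦ u ⟧ (bilin m ⟦ v ⟧ ⟦ w ⟧))
                     (E.assoc ⟦ u ⟧ ⟦ v ⟧ ⟦ w ⟧) F ⟩
      ⟪ bilin m ⟦ u ⟧ (bilin m ⟦ v ⟧ ⟦ w ⟧) ∣ F ⟫
        ≈⟨ pair-bilinear m ⟦ u ⟧ (bilin m ⟦ v ⟧ ⟦ w ⟧) F ⟩
      ⟪ ⟦ u ⟧ ∣ (λ u′ → ⟪ bilin m ⟦ v ⟧ ⟦ w ⟧ ∣ (λ p → ⟪ m u′ p ∣ F ⟫) ⟫) ⟫
        ≈⟨ pair-⟦⟧ u (λ u′ → ⟪ bilin m ⟦ v ⟧ ⟦ w ⟧ ∣ (λ p → ⟪ m u′ p ∣ F ⟫) ⟫) ⟩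
      ⟪ bilin m ⟦ v ⟧ ⟦ w ⟧ ∣ (λ p → ⟪ m u p ∣ F ⟫) ⟫
        ≈⟨ pair-single v w _ ⟩
      ⟪ m v w ∣ (λ p → ⟪ m u p ∣ F ⟫) ⟫ ∎

    -- The coherence identities between structure constants.  For distinct letters they
    -- are the coefficients of c b a, b c a, b a c, a b c in (a □ b) □ c = a □ (b □ c).
    record Coherent (a b c : Letter) : Set ℓ where
      field
        k₁ : f₁ a b * f₁ a c * f₁ b c ≈ f₁ a b * f₁ b c
        k₂ : f₁ a b * f₁ a c * f₂ b c ≈ f₁ a c * f₂ b c
        k₃ : f₁ a b * f₂ a c * f₂ b c ≈ f₁ a b * f₂ a c
        k₄ : f₂ a b * f₂ b c * f₂ a c ≈ f₂ a b * f₂ b c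

    module Labelled (d : ℕ) (lab : Fin d → Letter) (lab-injective : Injective _≡_ _≡_ lab) where
      FWord : Set
      FWord = List (Fin d)

      spell : FWord → Word
      spell = map lab

      -- Polynomials in the 2d² structure constants f₁(lab i, lab j), f₂(lab i, lab j):
      -- variable number (t, i, j) is sent by ρ to the constant f_{t+1}(lab i, lab j).
      constant : Fin 2 → Fin d × Fin d → Carrier
      constant Fin.zero (i , j) = f₁ (lab i) (lab j)
      constant (Fin.suc _) (i , j) = f₂ (lab i) (lab j)

      entry : Fin (2 *ℕ (d *ℕ d)) → Carrier
      entry k = entryOf (remQuot (d *ℕ d) k)
        where
        entryOf : Fin 2 × Fin (d *ℕ d) → Carrier
        entryOf (t , ij) = constant t (remQuot d ij)

      ρ : Vec Carrier (2 *ℕ (d *ℕ d))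
      ρ = tabulate entry

      open Certificates ρ public

      gᶠ hᶠ : Fin d → Fin d → Coef
      gᶠ i j = var (combine {2} Fin.zero (combine i j))
      hᶠ i j = var (combine {2} (Fin.suc Fin.zero) (combine i j))

      ρ-combine : ∀ t i j → ⟦ var (combine {2} t (combine i j)) ⟧ᶜ ρ ≡ constant t (i , j)
      ρ-combine t i j =
        ≡.trans (lookup∘tabulate entry (combine t (combine i j)))
          (≡.trans (≡.cong (λ { (t′ , ij) → constant t′ (remQuot d ij) }) (remQuot-combine t (combine i j)))
                   (≡.cong (constant t) (remQuot-combine i j)))

      ⟦gᶠ⟧ : ∀ i j → ⟦ gᶠ i j ⟧ᶜ ρ ≡ f₁ (lab i) (lab j)
      ⟦gᶠ⟧ = ρ-combine Fin.zero

      ⟦hᶠ⟧ : ∀ i j → ⟦ hᶠ i j ⟧ᶜ ρ ≡ f₂ (lab i) (lab j)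
      ⟦hᶠ⟧ = ρ-combine (Fin.suc Fin.zero)

      FPoly : Set
      FPoly = List (Coef × FWord)

      ⟪_∣_⟫ᶠ : FPoly → (FWord → Carrier) → Carrier
      ⟪ [] ∣ Φ ⟫ᶠ = 0#
      ⟪ (k , w) ∷ P ∣ Φ ⟫ᶠ = ⟦ k ⟧ᶜ ρ * Φ w + ⟪ P ∣ Φ ⟫ᶠ

      scaleᶠ : Coef → FPoly → FPoly
      scaleᶠ k = map (map₁ (k :*_))

      snocᶠ : FPoly → Fin d → FPoly
      snocᶠ P a = map (map₂ (_∷ʳ a)) P

      bindᶠ : FPoly → (FWord → FPoly) → FPoly
      bindᶠ P k = concatMap (λ { (c , p) → scaleᶠ c (k p) }) P

      pairᶠ-cong : ∀ P {Φ Ψ} → (∀ w → Φ w ≈ Ψ w) → ⟪ P ∣ Φ ⟫ᶠ ≈ ⟪ P ∣ Ψ ⟫ᶠ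
      pairᶠ-cong [] e = refl
      pairᶠ-cong ((k , w) ∷ P) e = +-cong (*-congˡ (e w)) (pairᶠ-cong P e)

      pairᶠ-++ : ∀ P Q Φ → ⟪ P ++ Q ∣ Φ ⟫ᶠ ≈ ⟪ P ∣ Φ ⟫ᶠ + ⟪ Q ∣ Φ ⟫ᶠ
      pairᶠ-++ [] Q Φ = sym (+-identityˡ _)
      pairᶠ-++ ((k , w) ∷ P) Q Φ = trans (+-congˡ (pairᶠ-++ P Q Φ)) (sym (+-assoc _ _ _))

      pairᶠ-scale : ∀ k P Φ → ⟪ scaleᶠ k P ∣ Φ ⟫ᶠ ≈ ⟦ k ⟧ᶜ ρ * ⟪ P ∣ Φ ⟫ᶠ
      pairᶠ-scale k [] Φ = sym (zeroʳ _)
      pairᶠ-scale k ((c , w) ∷ P) Φ = trans (+-cong (*-assoc _ _ _) (pairᶠ-scale k P Φ)) (sym (distribˡ _ _ _))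

      pairᶠ-snoc : ∀ P a Φ → ⟪ snocᶠ P a ∣ Φ ⟫ᶠ ≈ ⟪ P ∣ Φ ∘ (_∷ʳ a) ⟫ᶠ
      pairᶠ-snoc [] a Φ = refl
      pairᶠ-snoc ((c , w) ∷ P) a Φ = +-congˡ (pairᶠ-snoc P a Φ)

      pairᶠ-bind : ∀ P k Φ → ⟪ bindᶠ P k ∣ Φ ⟫ᶠ ≈ ⟪ P ∣ (λ p → ⟪ k p ∣ Φ ⟫ᶠ) ⟫ᶠ
      pairᶠ-bind [] k Φ = refl
      pairᶠ-bind ((c , p) ∷ P) k Φ =
        trans (pairᶠ-++ (scaleᶠ c (k p)) _ Φ) (+-cong (pairᶠ-scale c (k p) Φ) (pairᶠ-bind P k Φ))

      -- The arguments are the words reversed, so that the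
      -- recursion (which peels off last letters) is structural.
      expandʳ : FWord → FWord → FPoly
      expandʳ [] v = [ con 1 , reverse v ]
      expandʳ (a ∷ u) [] = [ con 1 , reverse (a ∷ u) ]
      expandʳ (a ∷ u) (b ∷ v) =
        scaleᶠ (gᶠ a b) (snocᶠ (expandʳ u (b ∷ v)) a) ++ scaleᶠ (hᶠ a b) (snocᶠ (expandʳ (a ∷ u) v) b)

      expand : FWord → FWord → FPoly
      expand u v = expandʳ (reverse u) (reverse v)

      spell-∷ʳ : ∀ w a → spell (w ∷ʳ a) ≡ spell w ∷ʳ lab a
      spell-∷ʳ w a = map-++ lab w [ a ]

      rec-spelled : ∀ a u b v F →
        ⟪ m (spell (reverse (a ∷ u))) (spell (reverse (b ∷ v))) ∣ F ⟫
          ≈ f₁ (lab a) (lab b) * ⟪ m (spell (reverse u)) (spell (reverse (b ∷ v))) ∣ F ∘ (_∷ʳ lab a) ⟫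
          + f₂ (lab a) (lab b) * ⟪ m (spell (reverse (a ∷ u))) (spell (reverse v)) ∣ F ∘ (_∷ʳ lab b) ⟫
      rec-spelled a u b v F rewrite ≡.cong spell (unfold-reverse a u) | spell-∷ʳ (reverse u) a
                                  | ≡.cong spell (unfold-reverse b v) | spell-∷ʳ (reverse v) b = rec-pair _ _ _ _ F

      pairᶠ-branch : ∀ k P a (F : Word → Carrier) →
                     ⟪ scaleᶠ k (snocᶠ P a) ∣ F ∘ spell ⟫ᶠ ≈ ⟦ k ⟧ᶜ ρ * ⟪ P ∣ (λ w → F (spell w ∷ʳ lab a)) ⟫ᶠ
      pairᶠ-branch k P a F = trans (pairᶠ-scale k (snocᶠ P a) (F ∘ spell))
        (*-congˡ (trans (pairᶠ-snoc P a (F ∘ spell)) (pairᶠ-cong P (λ w → reflexive (≡.cong F (spell-∷ʳ w a))))))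

      -- The formal expansion computes the product m: every end weak shuffle product is
      -- determined by f₁, f₂ through its recursion.
      expandʳ-correct : ∀ u v F → ⟪ m (spell (reverse u)) (spell (reverse v)) ∣ F ⟫ ≈ ⟪ expandʳ u v ∣ F ∘ spell ⟫ᶠ
      expandʳ-correct [] v F = trans (unitˡ-pair _ F) (sym (trans (+-identityʳ _) (*-identityˡ _)))
      expandʳ-correct (a ∷ u) [] F = trans (unitʳ-pair _ F) (sym (trans (+-identityʳ _) (*-identityˡ _)))
      expandʳ-correct (a ∷ u) (b ∷ v) F = begin
        ⟪ m (spell (reverse (a ∷ u))) (spell (reverse (b ∷ v))) ∣ F ⟫
          ≈⟨ rec-spelled a u b v F ⟩
        f₁ (lab a) (lab b) * ⟪ m (spell (reverse u)) (spell (reverse (b ∷ v))) ∣ F ∘ (_∷ʳ lab a) ⟫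
          + f₂ (lab a) (lab b) * ⟪ m (spell (reverse (a ∷ u))) (spell (reverse v)) ∣ F ∘ (_∷ʳ lab b) ⟫
          ≈⟨ +-cong (*-cong (reflexive (≡.sym (⟦gᶠ⟧ a b))) (expandʳ-correct u (b ∷ v) _))
                    (*-cong (reflexive (≡.sym (⟦hᶠ⟧ a b))) (expandʳ-correct (a ∷ u) v _)) ⟩
        ⟦ gᶠ a b ⟧ᶜ ρ * ⟪ expandʳ u (b ∷ v) ∣ (λ w → F (spell w ∷ʳ lab a)) ⟫ᶠ
          + ⟦ hᶠ a b ⟧ᶜ ρ * ⟪ expandʳ (a ∷ u) v ∣ (λ w → F (spell w ∷ʳ lab b)) ⟫ᶠ
          ≈⟨ +-cong (pairᶠ-branch (gᶠ a b) (expandʳ u (b ∷ v)) a F) (pairᶠ-branch (hᶠ a b) (expandʳ (a ∷ u) v) b F) ⟨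
        ⟪ scaleᶠ (gᶠ a b) (snocᶠ (expandʳ u (b ∷ v)) a) ∣ F ∘ spell ⟫ᶠ
          + ⟪ scaleᶠ (hᶠ a b) (snocᶠ (expandʳ (a ∷ u) v) b) ∣ F ∘ spell ⟫ᶠ
          ≈⟨ pairᶠ-++ (scaleᶠ (gᶠ a b) (snocᶠ (expandʳ u (b ∷ v)) a)) _ (F ∘ spell) ⟨
        ⟪ expandʳ (a ∷ u) (b ∷ v) ∣ F ∘ spell ⟫ᶠ ∎

      expand-correct : ∀ u v F → ⟪ m (spell u) (spell v) ∣ F ⟫ ≈ ⟪ expand u v ∣ F ∘ spell ⟫ᶠ
      expand-correct u v F =
        ≡.subst₂ (λ u′ v′ → ⟪ m (spell u′) (spell v′) ∣ F ⟫ ≈ ⟪ expand u v ∣ F ∘ spell ⟫ᶠ)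
                 (reverse-involutive u) (reverse-involutive v) (expandʳ-correct (reverse u) (reverse v) F)

      expand-comm : ∀ u v F → ⟪ expand u v ∣ F ∘ spell ⟫ᶠ ≈ ⟪ expand v u ∣ F ∘ spell ⟫ᶠ
      expand-comm u v F = trans (sym (expand-correct u v F)) (trans (comm-pair _ _ F) (expand-correct v u F))

      expand-assoc : ∀ u v w F →
        ⟪ bindᶠ (expand u v) (λ p → expand p w) ∣ F ∘ spell ⟫ᶠ ≈ ⟪ bindᶠ (expand v w) (expand u) ∣ F ∘ spell ⟫ᶠ
      expand-assoc u v w F = begin
        ⟪ bindᶠ (expand u v) (λ p → expand p w) ∣ F ∘ spell ⟫ᶠ
          ≈⟨ pairᶠ-bind (expand u v) _ _ ⟩
        ⟪ expand u v ∣ (λ p → ⟪ expand p w ∣ F ∘ spell ⟫ᶠ) ⟫ᶠ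
          ≈⟨ pairᶠ-cong (expand u v) (λ p → expand-correct p w F) ⟨
        ⟪ expand u v ∣ (λ p → ⟪ m (spell p) (spell w) ∣ F ⟫) ⟫ᶠ
          ≈⟨ expand-correct u v _ ⟨
        ⟪ m (spell u) (spell v) ∣ (λ q → ⟪ m q (spell w) ∣ F ⟫) ⟫
          ≈⟨ assoc-pair _ _ _ F ⟩
        ⟪ m (spell v) (spell w) ∣ (λ q → ⟪ m (spell u) q ∣ F ⟫) ⟫
          ≈⟨ expand-correct v w _ ⟩
        ⟪ expand v w ∣ (λ p → ⟪ m (spell u) (spell p) ∣ F ⟫) ⟫ᶠ
          ≈⟨ pairᶠ-cong (expand v w) (λ p → expand-correct u p F) ⟩
        ⟪ expand v w ∣ (λ p → ⟪ expand u p ∣ F ∘ spell ⟫ᶠ) ⟫ᶠ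
          ≈⟨ pairᶠ-bind (expand v w) _ _ ⟨
        ⟪ bindᶠ (expand v w) (expand u) ∣ F ∘ spell ⟫ᶠ ∎

      coeffᶠ : FPoly → FWord → Coef
      coeffᶠ [] t = con 0
      coeffᶠ ((k , s) ∷ P) t with ≡-dec _≟Fin_ s t
      ... | yes _ = k :+ coeffᶠ P t
      ... | no _ = coeffᶠ P t

      pairᶠ-δ : ∀ P t → ⟪ P ∣ δ (spell t) ∘ spell ⟫ᶠ ≈ ⟦ coeffᶠ P t ⟧ᶜ ρ
      pairᶠ-δ [] t = refl
      pairᶠ-δ ((k , s) ∷ P) t with ≡-dec _≟Fin_ s t
      ... | yes ≡.refl = +-cong (trans (*-congˡ (δ-same (spell s))) (*-identityʳ _)) (pairᶠ-δ P t)
      ... | no s≢t = trans (+-congʳ (trans (*-congˡ (δ-other (s≢t ∘ map-injective lab-injective))) (zeroʳ _)))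
                           (trans (+-identityˡ _) (pairᶠ-δ P t))

      same-coefficients : ∀ P Q → (∀ F → ⟪ P ∣ F ∘ spell ⟫ᶠ ≈ ⟪ Q ∣ F ∘ spell ⟫ᶠ) →
                          ∀ t → ⟦ coeffᶠ P t ⟧ᶜ ρ ≈ ⟦ coeffᶠ Q t ⟧ᶜ ρ
      same-coefficients P Q e t = trans (sym (pairᶠ-δ P t)) (trans (e (δ (spell t))) (pairᶠ-δ Q t))

      commAt : FWord → FWord → FWord → Relation
      commAt u v t = coeffᶠ (expand u v) t ≐ coeffᶠ (expand v u) t
                       by same-coefficients (expand u v) (expand v u) (expand-comm u v) t

      assocAt : FWord → FWord → FWord → FWord → Relation
      assocAt u v w t = coeffᶠ L t ≐ coeffᶠ R t by same-coefficients L R (expand-assoc u v w) t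
        where
        L R : FPoly
        L = bindᶠ (expand u v) (λ p → expand p w)
        R = bindᶠ (expand v w) (expand u)

      K₁ᶠ K₂ᶠ K₃ᶠ K₄ᶠ : Fin d → Fin d → Fin d → Coef × Coef
      K₁ᶠ a b c = gᶠ a b :* gᶠ a c :* gᶠ b c , gᶠ a b :* gᶠ b c
      K₂ᶠ a b c = gᶠ a b :* gᶠ a c :* hᶠ b c , gᶠ a c :* hᶠ b c
      K₃ᶠ a b c = gᶠ a b :* hᶠ a c :* hᶠ b c , gᶠ a b :* hᶠ a c
      K₄ᶠ a b c = hᶠ a b :* hᶠ b c :* hᶠ a c , hᶠ a b :* hᶠ b c

    module OneLetter (x : Letter) (idem : f₁ x x * f₁ x x ≈ f₁ x x) where
      X : Fin 1
      X = Fin.zero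

      lab-injective : Injective _≡_ _≡_ (λ (_ : Fin 1) → x)
      lab-injective {Fin.zero} {Fin.zero} _ = ≡.refl

      open Labelled 1 (λ _ → x) lab-injective

      idem-g : Relation
      idem-g = gᶠ X X :* gᶠ X X ≐ gᶠ X X by idem

      -- f₂(x,x) is idempotent as well: compare coefficients of x x x in x □ x x = x x □ x
      idem-h : Relation
      idem-h = derive (hᶠ X X :* hᶠ X X , hᶠ X X)
                      ((con 1 , commAt [ X ] (X ∷ X ∷ []) (X ∷ X ∷ X ∷ [])) ∷ (con 1 , idem-g) ∷ []) refl

      coherent-xxx : Coherent x x x
      coherent-xxx = record
        { k₁ = follows (K₁ᶠ X X X) [ gᶠ X X , idem-g ] refl
        ; k₂ = follows (K₂ᶠ X X X) [ hᶠ X X , idem-g ] refl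
        ; k₃ = follows (K₃ᶠ X X X) [ gᶠ X X , idem-h ] refl
        ; k₄ = follows (K₄ᶠ X X X) [ hᶠ X X , idem-h ] refl
        }

    module TwoLetters (x y : Letter) (x≢y : x ≢ y) (idem : f₁ x x * f₁ x x ≈ f₁ x x) where
      X Y : Fin 2
      X = Fin.zero
      Y = Fin.suc Fin.zero

      lab : Fin 2 → Letter
      lab Fin.zero = x
      lab (Fin.suc _) = y

      lab-injective : Injective _≡_ _≡_ lab
      lab-injective {Fin.zero} {Fin.zero} _ = ≡.refl
      lab-injective {Fin.zero} {Fin.suc Fin.zero} x≡y = ⊥-elim (x≢y x≡y)
      lab-injective {Fin.suc Fin.zero} {Fin.zero} y≡x = ⊥-elim (x≢y (≡.sym y≡x))
      lab-injective {Fin.suc Fin.zero} {Fin.suc Fin.zero} _ = ≡.refl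

      open Labelled 2 lab lab-injective

      gxx hxx gxy hxy gyx hyx one : Coef
      gxx = gᶠ X X
      hxx = hᶠ X X
      gxy = gᶠ X Y
      hxy = hᶠ X Y
      gyx = gᶠ Y X
      hyx = hᶠ Y X
      one = con 1

      idem-g : Relation
      idem-g = gxx :* gxx ≐ gxx by idem

      -- single letters commute: f₁(x,y) = f₂(y,x) and f₁(y,x) = f₂(x,y)
      swap-xy swap-yx : Relation
      swap-xy = commAt [ X ] [ Y ] (Y ∷ X ∷ [])
      swap-yx = commAt [ Y ] [ X ] (X ∷ Y ∷ [])

      -- f₁(y,x) f₂(x,x) = f₁(y,x) f₁(x,x), from the coefficient of x y x in x □ y x = y x □ x
      gyx·hxx : Relation
      gyx·hxx = derive (gyx :* hxx , gyx :* gxx)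
        ((one , commAt [ X ] (Y ∷ X ∷ []) (X ∷ Y ∷ X ∷ [])) ∷ (hxx , swap-yx) ∷ []) refl

      -- (f₁ + f₂)(x,x) f₁(y,x)² = (f₁ + f₂)(x,x) f₁(y,x), from the coefficient of x x y
      -- in (x □ x) □ y = x □ (x □ y)
      gyx²·[g+h]xx : Relation
      gyx²·[g+h]xx = derive ((gxx :+ hxx) :* gyx :* gyx , (gxx :+ hxx) :* gyx)
        ((one , reversed (assocAt [ X ] [ X ] [ Y ] (X ∷ X ∷ Y ∷ [])))
          ∷ ((gxx :+ hxx) :* (gyx :+ hxy) , swap-yx) ∷ (gxx :+ hxx , reversed swap-yx) ∷ []) refl

      -- f₁(x,x) f₁(y,x)² = f₁(x,x) f₁(y,x), using the coefficient of x x x y in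
      -- (y □ x) □ x x = y □ (x □ x x)
      gyx²·gxx : Relation
      gyx²·gxx = derive (gxx :* gyx :* gyx , gxx :* gyx)
        ((one , assocAt [ Y ] [ X ] (X ∷ X ∷ []) (X ∷ X ∷ X ∷ Y ∷ [])) ∷ (hxx , reversed gyx²·[g+h]xx) ∷ []) refl

      xxy₁ xxy₂ yxx₂ yxx₃ yxx₄ : Relation
      xxy₁ = derive (K₁ᶠ X X Y) (only (assocAt [ X ] [ X ] [ Y ] (Y ∷ X ∷ X ∷ []))) refl
      xxy₂ = derive (K₂ᶠ X X Y) (only (assocAt [ X ] [ X ] [ Y ] (X ∷ Y ∷ X ∷ []))) refl
      yxx₂ = derive (K₂ᶠ Y X X) ((gyx , gyx·hxx) ∷ (one , gyx²·gxx) ∷ (one , reversed gyx·hxx) ∷ []) refl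
      yxx₃ = derive (K₃ᶠ Y X X) (only (reversed (assocAt [ Y ] [ X ] [ X ] (X ∷ Y ∷ X ∷ [])))) refl
      yxx₄ = derive (K₄ᶠ Y X X) (only (reversed (assocAt [ Y ] [ X ] [ X ] (Y ∷ X ∷ X ∷ [])))) refl

      coherent-xxy : Coherent x x y
      coherent-xxy = record
        { k₁ = holds xxy₁
        ; k₂ = holds xxy₂
        ; k₃ = follows (K₃ᶠ X X Y)
                 ((one , gyx²·gxx) ∷ (gxx :* (hxy :+ gyx) , reversed swap-yx) ∷ (gxx , swap-yx) ∷ []) refl
        ; k₄ = follows (K₄ᶠ X X Y)
                 ((one , yxx₂) ∷ (hxx :* (hxy :+ gyx) , reversed swap-yx) ∷ (hxx , swap-yx) ∷ []) refl
        }

      coherent-yxx : Coherent y x x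
      coherent-yxx = record
        { k₁ = follows (K₁ᶠ Y X X) (only gyx²·gxx) refl
        ; k₂ = holds yxx₂
        ; k₃ = holds yxx₃
        ; k₄ = holds yxx₄
        }

      -- the pattern (x, y, x) is the image of the other two under the swaps
      coherent-xyx : Coherent x y x
      coherent-xyx = record
        { k₁ = follows (K₁ᶠ X Y X) ((one , xxy₂) ∷ (gxy :* gxx , swap-yx) ∷ (gxy , reversed swap-yx) ∷ []) refl
        ; k₂ = follows (K₂ᶠ X Y X) ((one , xxy₁) ∷ (gxx :* gxy , reversed swap-xy) ∷ (gxx , swap-xy) ∷ []) refl
        ; k₃ = follows (K₃ᶠ X Y X) ((one , yxx₄) ∷ (hxx :* hyx , swap-xy) ∷ (hxx , reversed swap-xy) ∷ []) refl
        ; k₄ = follows (K₄ᶠ X Y X) ((one , yxx₃) ∷ (hyx :* hxx , reversed swap-yx) ∷ (hyx , swap-yx) ∷ []) refl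
        }

    module ThreeLetters (a b c : Letter) (a≢b : a ≢ b) (b≢c : b ≢ c) (a≢c : a ≢ c) where
      A B C : Fin 3
      A = Fin.zero
      B = Fin.suc Fin.zero
      C = Fin.suc (Fin.suc Fin.zero)

      lab : Fin 3 → Letter
      lab Fin.zero = a
      lab (Fin.suc Fin.zero) = b
      lab (Fin.suc (Fin.suc _)) = c

      lab-injective : Injective _≡_ _≡_ lab
      lab-injective {Fin.zero} {Fin.zero} _ = ≡.refl
      lab-injective {Fin.zero} {Fin.suc Fin.zero} e = ⊥-elim (a≢b e)
      lab-injective {Fin.zero} {Fin.suc (Fin.suc Fin.zero)} e = ⊥-elim (a≢c e)
      lab-injective {Fin.suc Fin.zero} {Fin.zero} e = ⊥-elim (a≢b (≡.sym e))
      lab-injective {Fin.suc Fin.zero} {Fin.suc Fin.zero} _ = ≡.refl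
      lab-injective {Fin.suc Fin.zero} {Fin.suc (Fin.suc Fin.zero)} e = ⊥-elim (b≢c e)
      lab-injective {Fin.suc (Fin.suc Fin.zero)} {Fin.zero} e = ⊥-elim (a≢c (≡.sym e))
      lab-injective {Fin.suc (Fin.suc Fin.zero)} {Fin.suc Fin.zero} e = ⊥-elim (b≢c (≡.sym e))
      lab-injective {Fin.suc (Fin.suc Fin.zero)} {Fin.suc (Fin.suc Fin.zero)} _ = ≡.refl

      open Labelled 3 lab lab-injective

      coherent-abc : Coherent a b c
      coherent-abc = record
        { k₁ = follows (K₁ᶠ A B C) (only (assocAt [ A ] [ B ] [ C ] (C ∷ B ∷ A ∷ []))) refl
        ; k₂ = follows (K₂ᶠ A B C) (only (assocAt [ A ] [ B ] [ C ] (B ∷ C ∷ A ∷ []))) refl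
        ; k₃ = follows (K₃ᶠ A B C) (only (reversed (assocAt [ A ] [ B ] [ C ] (B ∷ A ∷ C ∷ [])))) refl
        ; k₄ = follows (K₄ᶠ A B C) (only (reversed (assocAt [ A ] [ B ] [ C ] (A ∷ B ∷ C ∷ [])))) refl
        }

    -- the hypothesis f₁(a,a) ∈ {0, 1} is used only through idempotence
    idempotent : (∀ a → (f₁ a a ≈ 0#) ⊎ (f₁ a a ≈ 1#)) → ∀ a → f₁ a a * f₁ a a ≈ f₁ a a
    idempotent hyp a with hyp a
    ... | inj₁ e = trans (*-cong e e) (trans (zeroˡ 0#) (sym e))
    ... | inj₂ e = trans (*-cong e e) (trans (*-identityˡ 1#) (sym e))

    coherent : (∀ a → f₁ a a * f₁ a a ≈ f₁ a a) → ∀ a b c → Coherent a b c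
    coherent idem a b c with a ≟X b | b ≟X c | a ≟X c
    ... | yes ≡.refl | yes ≡.refl | _ = OneLetter.coherent-xxx a (idem a)
    ... | yes ≡.refl | no a≢c | _ = TwoLetters.coherent-xxy a c a≢c (idem a)
    ... | no a≢b | yes ≡.refl | _ = TwoLetters.coherent-yxx b a (a≢b ∘ ≡.sym) (idem b)
    ... | no a≢b | no _ | yes ≡.refl = TwoLetters.coherent-xyx a b a≢b (idem a)
    ... | no a≢b | no b≢c | no a≢c = ThreeLetters.coherent-abc a b c a≢b b≢c a≢c

    pair-wedge : ∀ u a v b (G : NEWord → Carrier) →
                 ⟪ wedgeW (u , a) (v , b) ∣ G ⟫ ≈ f₁ a b * ⟪ m u (v ∷ʳ b) ∣ (λ p → G (p , a)) ⟫
    pair-wedge u a v b G = trans (pair-relabel (_, a) (scale (f₁ a b) (m u (v ∷ʳ b))) G)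
                                 (pair-scale (f₁ a b) (m u (v ∷ʳ b)) _)

    pair-vee : ∀ u a v b (G : NEWord → Carrier) →
               ⟪ veeW (u , a) (v , b) ∣ G ⟫ ≈ f₂ a b * ⟪ m (u ∷ʳ a) v ∣ (λ p → G (p , b)) ⟫
    pair-vee u a v b G = trans (pair-relabel (_, b) (scale (f₂ a b) (m (u ∷ʳ a) v)) G)
                               (pair-scale (f₂ a b) (m (u ∷ʳ a) v) _)

    module OnBasisWords (coherence : ∀ a b c → Coherent a b c) where

      -- (r ∧ s) ∧ t = r ∧ (s ∧ t) + r ∧ (s ∨ t): expand with associativity and the
      -- recursion, then use the coherence identities k₁, k₂
      dend₁-basis : ∀ r s t (G : NEWord → Carrier) →
        ⟪ wedgeW r s ∣ (λ r′ → ⟪ wedgeW r′ t ∣ G ⟫) ⟫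
          ≈ ⟪ wedgeW s t ∣ (λ s′ → ⟪ wedgeW r s′ ∣ G ⟫) ⟫ + ⟪ veeW s t ∣ (λ s′ → ⟪ wedgeW r s′ ∣ G ⟫) ⟫
      dend₁-basis (u , a) (v , b) (w , c) G = begin
        ⟪ wedgeW (u , a) (v , b) ∣ (λ r′ → ⟪ wedgeW r′ (w , c) ∣ G ⟫) ⟫
          ≈⟨ trans (pair-wedge u a v b _) (*-congˡ (pair-pull (m u (v ∷ʳ b)) (f₁ a c) (λ p → pair-wedge p a w c G))) ⟩
        f₁ a b * (f₁ a c * ⟪ m u (v ∷ʳ b) ∣ (λ p → ⟪ m p (w ∷ʳ c) ∣ Gₐ ⟫) ⟫)
          ≈⟨ *-congˡ (*-congˡ (trans (assoc-pair u (v ∷ʳ b) (w ∷ʳ c) Gₐ) (rec-pair v w b c _))) ⟩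
        f₁ a b * (f₁ a c * (f₁ b c * A + f₂ b c * B))
          ≈⟨ distribute _ _ _ _ A B ⟩
        f₁ a b * f₁ a c * f₁ b c * A + f₁ a b * f₁ a c * f₂ b c * B
          ≈⟨ +-cong (*-congʳ k₁) (*-congʳ k₂) ⟩
        f₁ a b * f₁ b c * A + f₁ a c * f₂ b c * B
          ≈⟨ regroup _ _ _ _ A B ⟩
        f₁ b c * (f₁ a b * A) + f₂ b c * (f₁ a c * B)
          ≈⟨ +-cong (trans (pair-wedge v b w c _) (*-congˡ (pair-pull (m v (w ∷ʳ c)) (f₁ a b) (λ p → pair-wedge u a p b G))))
                    (trans (pair-vee v b w c _) (*-congˡ (pair-pull (m (v ∷ʳ b) w) (f₁ a c) (λ p → pair-wedge u a p c G)))) ⟨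
        ⟪ wedgeW (v , b) (w , c) ∣ (λ s′ → ⟪ wedgeW (u , a) s′ ∣ G ⟫) ⟫
          + ⟪ veeW (v , b) (w , c) ∣ (λ s′ → ⟪ wedgeW (u , a) s′ ∣ G ⟫) ⟫ ∎
        where
        open Coherent (coherence a b c)
        Gₐ : Word → Carrier
        Gₐ p = G (p , a)
        A B : Carrier
        A = ⟪ m v (w ∷ʳ c) ∣ (λ p → ⟪ m u (p ∷ʳ b) ∣ Gₐ ⟫) ⟫
        B = ⟪ m (v ∷ʳ b) w ∣ (λ p → ⟪ m u (p ∷ʳ c) ∣ Gₐ ⟫) ⟫
        distribute : ∀ x y z t A B → x * (y * (z * A + t * B)) ≈ x * y * z * A + x * y * t * B
        distribute = solve 6 (λ x y z t A B →
          x :* (y :* (z :* A :+ t :* B)) := x :* y :* z :* A :+ x :* y :* t :* B) refl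
        regroup : ∀ x y z t A B → x * z * A + y * t * B ≈ z * (x * A) + t * (y * B)
        regroup = solve 6 (λ x y z t A B → x :* z :* A :+ y :* t :* B := z :* (x :* A) :+ t :* (y :* B)) refl

      -- (r ∨ s) ∧ t = r ∨ (s ∧ t); this one needs only associativity
      dend₂-basis : ∀ r s t (G : NEWord → Carrier) →
        ⟪ veeW r s ∣ (λ r′ → ⟪ wedgeW r′ t ∣ G ⟫) ⟫ ≈ ⟪ wedgeW s t ∣ (λ s′ → ⟪ veeW r s′ ∣ G ⟫) ⟫
      dend₂-basis (u , a) (v , b) (w , c) G = begin
        ⟪ veeW (u , a) (v , b) ∣ (λ r′ → ⟪ wedgeW r′ (w , c) ∣ G ⟫) ⟫
          ≈⟨ trans (pair-vee u a v b _) (*-congˡ (pair-pull (m (u ∷ʳ a) v) (f₁ b c) (λ p → pair-wedge p b w c G))) ⟩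
        f₂ a b * (f₁ b c * ⟪ m (u ∷ʳ a) v ∣ (λ p → ⟪ m p (w ∷ʳ c) ∣ G_b ⟫) ⟫)
          ≈⟨ *-congˡ (*-congˡ (assoc-pair (u ∷ʳ a) v (w ∷ʳ c) G_b)) ⟩
        f₂ a b * (f₁ b c * ⟪ m v (w ∷ʳ c) ∣ (λ p → ⟪ m (u ∷ʳ a) p ∣ G_b ⟫) ⟫)
          ≈⟨ x*[y*z]≈y*[x*z] (f₂ a b) (f₁ b c) _ ⟩
        f₁ b c * (f₂ a b * ⟪ m v (w ∷ʳ c) ∣ (λ p → ⟪ m (u ∷ʳ a) p ∣ G_b ⟫) ⟫)
          ≈⟨ trans (pair-wedge v b w c _) (*-congˡ (pair-pull (m v (w ∷ʳ c)) (f₂ a b) (λ p → pair-vee u a p b G))) ⟨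
        ⟪ wedgeW (v , b) (w , c) ∣ (λ s′ → ⟪ veeW (u , a) s′ ∣ G ⟫) ⟫ ∎
        where
        G_b : Word → Carrier
        G_b p = G (p , b)

      -- (r ∧ s) ∨ t + (r ∨ s) ∨ t = r ∨ (s ∨ t): use the coherence identities k₃, k₄,
      -- then fold back with the recursion and associativity
      dend₃-basis : ∀ r s t (G : NEWord → Carrier) →
        ⟪ wedgeW r s ∣ (λ r′ → ⟪ veeW r′ t ∣ G ⟫) ⟫ + ⟪ veeW r s ∣ (λ r′ → ⟪ veeW r′ t ∣ G ⟫) ⟫
          ≈ ⟪ veeW s t ∣ (λ s′ → ⟪ veeW r s′ ∣ G ⟫) ⟫
      dend₃-basis (u , a) (v , b) (w , c) G = begin
        ⟪ wedgeW (u , a) (v , b) ∣ (λ r′ → ⟪ veeW r′ (w , c) ∣ G ⟫) ⟫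
          + ⟪ veeW (u , a) (v , b) ∣ (λ r′ → ⟪ veeW r′ (w , c) ∣ G ⟫) ⟫
          ≈⟨ +-cong (trans (pair-wedge u a v b _) (*-congˡ (pair-pull (m u (v ∷ʳ b)) (f₂ a c) (λ p → pair-vee p a w c G))))
                    (trans (pair-vee u a v b _) (*-congˡ (pair-pull (m (u ∷ʳ a) v) (f₂ b c) (λ p → pair-vee p b w c G)))) ⟩
        f₁ a b * (f₂ a c * A) + f₂ a b * (f₂ b c * B)
          ≈⟨ sym (+-cong (*-assoc _ _ _) (*-assoc _ _ _)) ⟩
        f₁ a b * f₂ a c * A + f₂ a b * f₂ b c * B
          ≈⟨ sym (+-cong (*-congʳ k₃) (*-congʳ k₄)) ⟩
        f₁ a b * f₂ a c * f₂ b c * A + f₂ a b * f₂ b c * f₂ a c * B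
          ≈⟨ factor _ _ _ _ A B ⟩
        f₂ b c * (f₂ a c * (f₁ a b * A + f₂ a b * B))
          ≈⟨ *-congˡ (*-congˡ (trans (sym (rec-pair u v a b _)) (assoc-pair (u ∷ʳ a) (v ∷ʳ b) w G_c))) ⟩
        f₂ b c * (f₂ a c * ⟪ m (v ∷ʳ b) w ∣ (λ p → ⟪ m (u ∷ʳ a) p ∣ G_c ⟫) ⟫)
          ≈⟨ trans (pair-vee v b w c _) (*-congˡ (pair-pull (m (v ∷ʳ b) w) (f₂ a c) (λ p → pair-vee u a p c G))) ⟨
        ⟪ veeW (v , b) (w , c) ∣ (λ s′ → ⟪ veeW (u , a) s′ ∣ G ⟫) ⟫ ∎
        where
        open Coherent (coherence a b c)
        G_c : Word → Carrier
        G_c p = G (p , c)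
        A B : Carrier
        A = ⟪ m u (v ∷ʳ b) ∣ (λ p → ⟪ m (p ∷ʳ a) w ∣ G_c ⟫) ⟫
        B = ⟪ m (u ∷ʳ a) v ∣ (λ p → ⟪ m (p ∷ʳ b) w ∣ G_c ⟫) ⟫
        factor : ∀ x y z t A B → x * y * t * A + z * t * y * B ≈ t * (y * (x * A + z * B))
        factor = solve 6 (λ x y z t A B →
          x :* y :* t :* A :+ z :* t :* y :* B := t :* (y :* (x :* A :+ z :* B))) refl

    pair³ : Poly⁺ → Poly⁺ → Poly⁺ → (NEWord → NEWord → NEWord → Carrier) → Carrier
    pair³ x y z H = ⟪ x ∣ (λ r → ⟪ y ∣ (λ s → ⟪ z ∣ H r s ⟫) ⟫) ⟫

    pair³-cong : ∀ x y z {H H′ : NEWord → NEWord → NEWord → Carrier} →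
                 (∀ r s t → H r s t ≈ H′ r s t) → pair³ x y z H ≈ pair³ x y z H′
    pair³-cong x y z e = pair-cong x (λ r → pair-cong y (λ s → pair-cong z (e r s)))

    pair³-+ : ∀ x y z (H H′ : NEWord → NEWord → NEWord → Carrier) →
              pair³ x y z (λ r s t → H r s t + H′ r s t) ≈ pair³ x y z H + pair³ x y z H′
    pair³-+ x y z H H′ =
      trans (pair-cong x (λ r → trans (pair-cong y (λ s → pair-+ z (H r s) (H′ r s))) (pair-+ y _ _)))
            (pair-+ x _ _)

    pair-left : ∀ (M N : NEWord → NEWord → Poly⁺) x y z G →
      ⟪ bilin⁺ N (bilin⁺ M x y) z ∣ G ⟫ ≈ pair³ x y z (λ r s t → ⟪ M r s ∣ (λ r′ → ⟪ N r′ t ∣ G ⟫) ⟫)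
    pair-left M N x y z G =
      trans (pair-bilinear N (bilin⁺ M x y) z G)
            (trans (pair-bilinear M x y (λ r′ → ⟪ z ∣ (λ t → ⟪ N r′ t ∣ G ⟫) ⟫))
                   (pair-cong x (λ r → pair-cong y (λ s → pair-swap (M r s) z (λ r′ t → ⟪ N r′ t ∣ G ⟫)))))

    pair-right : ∀ (M N : NEWord → NEWord → Poly⁺) x y z G →
      ⟪ bilin⁺ M x (bilin⁺ N y z) ∣ G ⟫ ≈ pair³ x y z (λ r s t → ⟪ N s t ∣ (λ s′ → ⟪ M r s′ ∣ G ⟫) ⟫)
    pair-right M N x y z G =
      trans (pair-bilinear M x (bilin⁺ N y z) G)
            (pair-cong x (λ r → pair-bilinear N y z (λ s′ → ⟪ M r s′ ∣ G ⟫)))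

    -- each axiom: write both sides as triple pairings over basis words, then apply the
    -- corresponding identity on basis words termwise
    isDendriform : (∀ a b c → Coherent a b c) → IsDendriform
    isDendriform coherence = record { dend₁ = dend₁ ; dend₂ = dend₂ ; dend₃ = dend₃ }
      where
      open OnBasisWords coherence

      dend₁ : ∀ x y z → (x ∧ y) ∧ z ≈⁺ (x ∧ (y ∧ z)) ⊕ (x ∧ (y ∨ z))
      dend₁ x y z = ≈⁺-from-pairing ((x ∧ y) ∧ z) ((x ∧ (y ∧ z)) ⊕ (x ∧ (y ∨ z))) λ G →
        trans (pair-left wedgeW wedgeW x y z G)
        (trans (pair³-cong x y z (λ r s t → dend₁-basis r s t G))
        (trans (pair³-+ x y z _ _)
        (sym (trans (pair-++ (x ∧ (y ∧ z)) (x ∧ (y ∨ z)) G)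
                    (+-cong (pair-right wedgeW wedgeW x y z G) (pair-right wedgeW veeW x y z G))))))

      dend₂ : ∀ x y z → (x ∨ y) ∧ z ≈⁺ x ∨ (y ∧ z)
      dend₂ x y z = ≈⁺-from-pairing ((x ∨ y) ∧ z) (x ∨ (y ∧ z)) λ G →
        trans (pair-left veeW wedgeW x y z G)
        (trans (pair³-cong x y z (λ r s t → dend₂-basis r s t G))
               (sym (pair-right veeW wedgeW x y z G)))

      dend₃ : ∀ x y z → ((x ∧ y) ∨ z) ⊕ ((x ∨ y) ∨ z) ≈⁺ x ∨ (y ∨ z)
      dend₃ x y z = ≈⁺-from-pairing (((x ∧ y) ∨ z) ⊕ ((x ∨ y) ∨ z)) (x ∨ (y ∨ z)) λ G →
        trans (pair-++ ((x ∧ y) ∨ z) ((x ∨ y) ∨ z) G)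
        (trans (+-cong (pair-left wedgeW veeW x y z G) (pair-left veeW veeW x y z G))
        (trans (sym (pair³-+ x y z _ _))
        (trans (pair³-cong x y z (λ r s t → dend₃-basis r s t G))
               (sym (pair-right veeW veeW x y z G)))))

mainTheorem8 : ∀ {c ℓ : Level} (K : Field c ℓ) (X : Alphabet)
    → let open Field K
          open Alphabet X
          open KX K X
      in (m : Word → Word → Poly) (f₁ f₂ : Letter → Letter → Carrier)
    → IsEndWeakShuffle m f₁ f₂
    → (∀ a → (f₁ a a ≈ 0#) ⊎ (f₁ a a ≈ 1#))
    → Dendriform.IsDendriform m f₁ f₂
mainTheorem8 K X m f₁ f₂ ews f₁-diagonal = isDendriform (coherent (idempotent f₁-diagonal))
  where open Proof.Shuffle K X m f₁ f₂ ews
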